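{- For every $x\in \Sigma^n$ and $\rho\in \mathbb{Z}_{\ge 0}$, we have $\mathsf{fold}_\rho(x)\ge \mathsf{fold}(x)$. Moreover, if $x$ is non-empty and irreducible, then $\mathsf{fold}_\rho(x) \le (1+2\rho)\mathsf{fold}(x)-\rho$.
   Context: $\Sigma$ carries a fixed-point-free involution $a\mapsto\overline{a}$, extended to strings by $\overline{y[1]\cdots y[m]}=\overline{y[m]}\cdots\overline{y[1]}$. $\mathsf{FOLD}(\Sigma)$ is generated by $S\to SS\mid\varnothing\mid aS\overline{a}$ ($a\in\Sigma$); $\mathsf{fold}(x)$ is the minimum number of deletions turning $x$ into a string of $\mathsf{FOLD}(\Sigma)$. $x$ is irreducible if $x[i+1]\ne\overline{x[i]}$ for all $i\in[1..|x|)$. A window is a nonempty integer interval $w\subseteq[1..n]$ with first index $s(w)$; $x[w]$ is the substring on $w$. A set $\mathcal{S}=\{(w_1,w_1'),\dots,(w_k,w_k')\}$ of window pairs is a consistent decomposition of $P=\bigcup_i(w_i\cup w_i')$ if the $2k$ windows are pairwise disjoint and $\{(s(w_i),s(w_i'))\}$ is a non-crossing matching (each $s(w_i)<s(w_i')$, and distinct pairs $(a,b),(a',b')$ satisfy $a<b<a'<b'$ or $a<a'<b'<b$ up to swapping). $\mathcal{S}$ is a window alignment of $x$ if moreover $x[w']=\overline{x[w]}$ for all $(w,w')\in\mathcal{S}$; $\mathsf{fold}_\rho(x,\mathcal{S})=n-|P|+\rho|\mathcal{S}|$ and $\mathsf{fold}_\rho(x)$ is its minimum over all window alignments of $x$.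 -}

module Defs where

open import Data.Nat using (ℕ; zero; suc; _+_; _*_; _∸_; _≤_; _<_)
open import Data.List using (List; []; _∷_; length; take; drop; reverse; map; concatMap)
open import Data.Nat.ListAction using (sum)
open import Data.List.Relation.Unary.All using (All)
open import Data.List.Relation.Unary.AllPairs using (AllPairs)
open import Data.List.Relation.Unary.Linked using (Linked)
open import Data.List.Relation.Binary.Sublist.Propositional using (_⊆_)
open import Data.Product using (_×_; _,_; Σ-syntax; proj₁; proj₂)
open import Data.Sum using (_⊎_)
open import Relation.Binary.PropositionalEquality using (_≡_; _≢_)

IsMinimum : (ℕ → Set) → ℕ → Set
IsMinimum P k = P k × (∀ m → P m → k ≤ m)

module Folding {A : Set} (bar : A → A) where

  barStr : List A → List A
  barStr y = reverse (map bar y)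

  data FOLD : List A → Set where
    fold-empty : FOLD []
    fold-cat   : ∀ {u v} → FOLD u → FOLD v → FOLD (u Data.List.++ v)
    fold-wrap  : ∀ a {u} → FOLD u → FOLD (a ∷ u Data.List.++ (bar a ∷ []))

  FoldCost : List A → ℕ → Set
  FoldCost x k = Σ[ y ∈ List A ] (y ⊆ x × FOLD y × k ≡ length x ∸ length y)

  IsFold : List A → ℕ → Set
  IsFold x = IsMinimum (FoldCost x)

  Irreducible : List A → Set
  Irreducible = Linked (λ a b → b ≢ bar a)

  -- a window: (start, length), 0-indexed positions start, …, start+length-1
  Window : Set
  Window = ℕ × ℕ

  start : Window → ℕ
  start = proj₁

  len : Window → ℕ
  len = proj₂

  ValidWindow : ℕ → Window → Set
  ValidWindow n (s , l) = 1 ≤ l × s + l ≤ n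

  Disjoint : Window → Window → Set
  Disjoint (s , l) (s' , l') = s + l ≤ s' ⊎ s' + l' ≤ s

  sub : List A → Window → List A
  sub x (s , l) = take l (drop s x)

  allWindows : List (Window × Window) → List Window
  allWindows = concatMap (λ p → proj₁ p ∷ proj₂ p ∷ [])

  starts : Window × Window → ℕ × ℕ
  starts (w , w') = start w , start w'

  NonCrossing : ℕ × ℕ → ℕ × ℕ → Set
  NonCrossing (a , b) (a' , b') =
    (b < a') ⊎ (b' < a) ⊎ (a < a' × a' < b' × b' < b) ⊎ (a' < a × a < b × b < b')

  -- consistent decomposition (of P = union of its windows) within [0..n)
  Consistent : ℕ → List (Window × Window) → Set
  Consistent n S =
    All (λ p → ValidWindow n (proj₁ p) × ValidWindow n (proj₂ p) × start (proj₁ p) < start (proj₂ p)) S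
    × AllPairs Disjoint (allWindows S)
    × AllPairs NonCrossing (map starts S)

  WindowAlignment : List A → List (Window × Window) → Set
  WindowAlignment x S =
    Consistent (length x) S × All (λ p → sub x (proj₂ p) ≡ barStr (sub x (proj₁ p))) S

  -- |P| (windows are pairwise disjoint)
  sizeP : List (Window × Window) → ℕ
  sizeP S = sum (map len (allWindows S))

  foldρCost : ℕ → List A → List (Window × Window) → ℕ
  foldρCost ρ x S = length x ∸ sizeP S + ρ * length S

  FoldρCost : ℕ → List A → ℕ → Set
  FoldρCost ρ x k = Σ[ S ∈ List (Window × Window) ] (WindowAlignment x S × k ≡ foldρCost ρ x S)

  IsFoldρ : ℕ → List A → ℕ → Set
  IsFoldρ ρ x = IsMinimum (FoldρCost ρ x)

{-# OPTIONS --safe #-}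
module Submission where

-- An alignment yields a FOLD subsequence.  In a region [lo, hi) either no pair starts at lo, and lo
-- can be dropped, or some pair (w, w′) starts at lo; since the pairs do not cross, every other pair
-- lies strictly between w and w′ or after w′.  Recursively both parts carry FOLD subsequences y₁, y₂,
-- and x[w] y₁ bar(x[w]) y₂ is again in FOLD.  So the positions P of an alignment contain a FOLD
-- subsequence, and fold ≤ n − |P| ≤ fold_ρ.
--
-- Conversely, read an optimal FOLD subsequence of x as a forest of matched pairs together with the
-- d = fold(x) deleted letters, and merge every maximal run a₁(a₂(…)ā₂)ā₁ of directly nested pairs into
-- a chain, which becomes a single window pair.  Irreducibility forces every matched pair to enclose
-- some letter, so a new chain is only opened around a forest that has two top-level items or is a
-- single deletion; this keeps (#chains) + (#top-level items) ≤ 2d.  A non-empty x has a top-level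
-- item, so there are at most 2d − 1 pairs and fold_ρ ≤ d + ρ(2d − 1).

open import Defs
open import Data.Nat using (ℕ; zero; suc; _+_; _*_; _∸_; _≤_; _<_; _>_; z≤n; s≤s; _<?_)
open import Data.Nat.Properties
open import Data.Nat.Tactic.RingSolver using (solve-∀)
open import Algebra.Properties.CommutativeSemigroup +-commutativeSemigroup using (x∙yz≈y∙xz; interchange)
open import Data.List using (List; []; _∷_; _++_; length; take; drop; map; filter)
open import Data.List.Properties
  using (++-assoc; ++-identityʳ; length-++; length-map; length-reverse; reverse-++; take-all; take-[]; drop-drop; map-++; map-∘)
open import Data.Nat.ListAction using (sum)
open import Data.Nat.ListAction.Properties using (sum-++)
open import Data.List.Relation.Unary.All as All using (All; []; _∷_)
import Data.List.Relation.Unary.All.Properties as All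
open import Data.List.Relation.Unary.Any as Any using (Any; here; there; any?)
open import Data.List.Relation.Unary.AllPairs as AllPairs using (AllPairs; []; _∷_)
import Data.List.Relation.Unary.AllPairs.Properties as AllPairs
open import Data.List.Relation.Unary.Linked as Linked using (Linked; []; [-]; _∷_)
open import Data.List.Relation.Binary.Sublist.Propositional using (_⊆_; []; _∷_; _∷ʳ_; ⊆-reflexive; minimum)
open import Data.List.Relation.Binary.Sublist.Propositional.Properties using (++⁺; ++⁺ˡ; ++⁺ʳ)
open import Data.Product using (_×_; _,_; Σ-syntax; proj₁; proj₂; uncurry)
open import Data.Sum using (inj₁; inj₂)
open import Data.Empty using (⊥-elim)
open import Level using (0ℓ)
open import Function using (id; _∘_)
open import Relation.Nullary using (¬_; yes; no)
open import Relation.Unary using (Pred; Decidable)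
open import Relation.Unary.Properties using (∁?)
open import Relation.Binary using (Rel; Symmetric)
open import Relation.Binary.PropositionalEquality
open import Relation.Binary.Definitions using (DecidableEquality)

m+n≤o⇒m<o : ∀ m {n o} → n > 0 → m + n ≤ o → m < o
m+n≤o⇒m<o m n>0 h = <-≤-trans (m<m+n m n>0) h

+-monoʳ-end : ∀ k {s l b} → s + l ≤ b → k + s + l ≤ k + b
+-monoʳ-end k {s} {l} h = ≤-trans (≤-reflexive (+-assoc k s l)) (+-monoʳ-≤ k h)

new-chain-bound : ∀ {k k′ i′} d d′ → k + 2 ≤ 2 * d → k′ + i′ ≤ 2 * d′ → suc (k + k′) + suc i′ ≤ 2 * (d + d′)
new-chain-bound {k} {k′} {i′} d d′ h h′ =
  subst₂ _≤_ (rearrange k k′ i′) (sym (*-distribˡ-+ 2 d d′)) (+-mono-≤ h h′)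
  where
  rearrange : ∀ k k′ i′ → k + 2 + (k′ + i′) ≡ suc (k + k′) + suc i′
  rearrange = solve-∀

cost-bound : ∀ ρ {d k} → k + 1 ≤ 2 * d → d + ρ * k + ρ ≤ (1 + 2 * ρ) * d
cost-bound ρ {d} {k} h = subst₂ _≤_ (lhs d k ρ) (rhs d ρ) (+-monoʳ-≤ d (*-monoʳ-≤ ρ h))
  where
  lhs : ∀ d k ρ → d + ρ * (k + 1) ≡ d + ρ * k + ρ
  lhs = solve-∀
  rhs : ∀ d ρ → d + ρ * (2 * d) ≡ (1 + 2 * ρ) * d
  rhs = solve-∀

module _ {A : Set} where

  drop-length-++ : ∀ (u v : List A) → drop (length u) (u ++ v) ≡ v
  drop-length-++ []      v = refl
  drop-length-++ (a ∷ u) v = drop-length-++ u v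

  take-++-≤ : ∀ (u v : List A) l → l ≤ length u → take l (u ++ v) ≡ take l u
  take-++-≤ u       v zero    _       = refl
  take-++-≤ (a ∷ u) v (suc l) (s≤s h) = cong (a ∷_) (take-++-≤ u v l h)

  take-length-++ : ∀ (u v : List A) → take (length u) (u ++ v) ≡ u
  take-length-++ []      v = refl
  take-length-++ (a ∷ u) v = cong (a ∷_) (take-length-++ u v)

  take-+ : ∀ m n (xs : List A) → take (m + n) xs ≡ take m xs ++ take n (drop m xs)
  take-+ zero    n xs       = refl
  take-+ (suc m) n []       = sym (take-[] n)
  take-+ (suc m) n (x ∷ xs) = cong (x ∷_) (take-+ m n xs)

  length-take-drop : ∀ (xs : List A) s l → s + l ≤ length xs → length (take l (drop s xs)) ≡ l
  length-take-drop xs       zero    zero    _       = refl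
  length-take-drop (x ∷ xs) zero    (suc l) (s≤s h) = cong suc (length-take-drop xs zero l h)
  length-take-drop (x ∷ xs) (suc s) l       (s≤s h) = length-take-drop xs s l h

  ⊆-++⁻ : ∀ (u : List A) {v x} → u ++ v ⊆ x →
          Σ[ x₁ ∈ List A ] Σ[ x₂ ∈ List A ] (x ≡ x₁ ++ x₂ × u ⊆ x₁ × v ⊆ x₂)
  ⊆-++⁻ []      s = [] , _ , refl , [] , s
  ⊆-++⁻ (a ∷ u) (b ∷ʳ s) with x₁ , x₂ , refl , s₁ , s₂ ← ⊆-++⁻ (a ∷ u) s = b ∷ x₁ , x₂ , refl , b ∷ʳ s₁ , s₂
  ⊆-++⁻ (a ∷ u) (e ∷ s)  with x₁ , x₂ , refl , s₁ , s₂ ← ⊆-++⁻ u s       = _ ∷ x₁ , x₂ , refl , e ∷ s₁ , s₂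

  ∷-⊆⁻ : ∀ {c : A} {v x} → c ∷ v ⊆ x → Σ[ d ∈ List A ] Σ[ x′ ∈ List A ] (x ≡ d ++ c ∷ x′ × v ⊆ x′)
  ∷-⊆⁻ (b ∷ʳ s) with d , x′ , refl , s′ ← ∷-⊆⁻ s = b ∷ d , x′ , refl , s′
  ∷-⊆⁻ (refl ∷ s) = [] , _ , refl , s

  ⊆-++-∷⁻ : ∀ (u : List A) {c v x} → u ++ c ∷ v ⊆ x →
            Σ[ x₁ ∈ List A ] Σ[ x₂ ∈ List A ] (x ≡ x₁ ++ c ∷ x₂ × u ⊆ x₁ × v ⊆ x₂)
  ⊆-++-∷⁻ u s with x₁ , _ , refl , s₁ , s₂ ← ⊆-++⁻ u s with d , x₃ , refl , s₃ ← ∷-⊆⁻ s₂ =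
    x₁ ++ d , x₃ , sym (++-assoc x₁ d _) , ++⁺ʳ d s₁ , s₃

module _ {A : Set} {ℓ} {R : Rel A ℓ} where

  Linked-++⁻ˡ : ∀ xs {ys : List A} → Linked R (xs ++ ys) → Linked R xs
  Linked-++⁻ˡ []           _       = []
  Linked-++⁻ˡ (x ∷ [])     _       = [-]
  Linked-++⁻ˡ (x ∷ y ∷ xs) (r ∷ l) = r ∷ Linked-++⁻ˡ (y ∷ xs) l

  Linked-++⁻ʳ : ∀ xs {ys : List A} → Linked R (xs ++ ys) → Linked R ys
  Linked-++⁻ʳ []       l = l
  Linked-++⁻ʳ (x ∷ xs) l = Linked-++⁻ʳ xs (Linked.tail l)

  AllPairs-─ : Symmetric R → ∀ {p} {P : Pred A p} {xs} (i : Any P xs) → AllPairs R xs →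
               All (R (Any.lookup i)) (xs Any.─ i) × AllPairs R (xs Any.─ i)
  AllPairs-─ sym (here _)  (r ∷ rs) = r , rs
  AllPairs-─ sym (there i) (r ∷ rs) with rᵢ , rsᵢ ← AllPairs-─ sym i rs =
    sym (proj₁ (All.lookupAny r i)) ∷ rᵢ , All.─⁺ i r ∷ rsᵢ

module _ {A : Set} (f : A → ℕ) where

  sum-map-─ : ∀ {p} {P : Pred A p} {xs} (i : Any P xs) →
              sum (map f xs) ≡ f (Any.lookup i) + sum (map f (xs Any.─ i))
  sum-map-─ (here _)                = refl
  sum-map-─ {xs = x ∷ xs} (there i) =
    trans (cong (f x +_) (sum-map-─ i)) (x∙yz≈y∙xz (f x) (f (Any.lookup i)) _)

  sum-map-filter : ∀ {p} {P : Pred A p} (P? : Decidable P) xs →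
                   sum (map f xs) ≡ sum (map f (filter P? xs)) + sum (map f (filter (∁? P?) xs))
  sum-map-filter P? []       = refl
  sum-map-filter P? (x ∷ xs) with P? x
  ... | yes _ = trans (cong (f x +_) (sum-map-filter P? xs)) (sym (+-assoc (f x) _ _))
  ... | no  _ = trans (cong (f x +_) (sum-map-filter P? xs)) (x∙yz≈y∙xz (f x) (sum (map f (filter P? xs))) _)

module _ {A : Set} (bar : A → A) where
  open Folding bar

  sub-++ʳ : ∀ (u x : List A) s l → sub (u ++ x) (length u + s , l) ≡ sub x (s , l)
  sub-++ʳ u x s l =
    cong (take l) (trans (sym (drop-drop (length u) s (u ++ x))) (cong (drop s) (drop-length-++ u x)))

  sub-++ˡ : ∀ (x v : List A) s l → s + l ≤ length x → sub (x ++ v) (s , l) ≡ sub x (s , l)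
  sub-++ˡ x       v zero    l h       = take-++-≤ x v l h
  sub-++ˡ (a ∷ x) v (suc s) l (s≤s h) = sub-++ˡ x v s l h

  sub-+ : ∀ (x : List A) s l₁ l₂ → sub x (s , l₁ + l₂) ≡ sub x (s , l₁) ++ sub x (s + l₁ , l₂)
  sub-+ x s l₁ l₂ =
    trans (take-+ l₁ l₂ (drop s x)) (cong (λ z → take l₁ (drop s x) ++ take l₂ z) (drop-drop s l₁ x))

  seg : List A → ℕ → ℕ → List A
  seg x lo hi = sub x (lo , hi ∸ lo)

  seg-split : ∀ x {lo mid hi} → lo ≤ mid → mid ≤ hi → seg x lo hi ≡ seg x lo mid ++ seg x mid hi
  seg-split x {lo} lo≤mid mid≤hi with a , refl ← m≤n⇒∃[o]m+o≡n lo≤mid | b , refl ← m≤n⇒∃[o]m+o≡n mid≤hi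
    rewrite m+n∸m≡n (lo + a) b | +-assoc lo a b | m+n∸m≡n lo (a + b) | m+n∸m≡n lo a = sub-+ x lo a b

  seg-sub : ∀ x lo l → seg x lo (lo + l) ≡ sub x (lo , l)
  seg-sub x lo l = cong (λ z → sub x (lo , z)) (m+n∸m≡n lo l)

  barStr-∷ : ∀ a (u : List A) → barStr (a ∷ u) ≡ barStr u ++ bar a ∷ []
  barStr-∷ a u = reverse-++ (bar a ∷ []) (map bar u)

  length-barStr : ∀ (u : List A) → length (barStr u) ≡ length u
  length-barStr u = trans (length-reverse (map bar u)) (length-map bar u)

  FOLD-wrap : ∀ (u : List A) {y} → FOLD y → FOLD (u ++ y ++ barStr u)
  FOLD-wrap []      {y} f = subst FOLD (sym (++-identityʳ y)) f
  FOLD-wrap (a ∷ u) {y} f = subst FOLD (cong (a ∷_) reassociate) (fold-wrap a (FOLD-wrap u f))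
    where
    open ≡-Reasoning
    reassociate : (u ++ y ++ barStr u) ++ bar a ∷ [] ≡ u ++ y ++ barStr (a ∷ u)
    reassociate = begin
      (u ++ y ++ barStr u) ++ bar a ∷ []  ≡⟨ ++-assoc u _ _ ⟩
      u ++ (y ++ barStr u) ++ bar a ∷ []  ≡⟨ cong (u ++_) (++-assoc y _ _) ⟩
      u ++ y ++ barStr u ++ bar a ∷ []    ≡⟨ cong (λ z → u ++ y ++ z) (barStr-∷ a u) ⟨
      u ++ y ++ barStr (a ∷ u)            ∎

  Pair : Set
  Pair = Window × Window

  Within : ℕ → ℕ → Pair → Set
  Within lo hi ((s , l) , (s′ , l′)) = 1 ≤ l × lo ≤ s × s + l ≤ s′ × 1 ≤ l′ × s′ + l′ ≤ hi

  Compatible : Pair → Pair → Set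
  Compatible p@(w₁ , w₁′) q@(w₂ , w₂′) =
    (Disjoint w₁ w₂ × Disjoint w₁ w₂′ × Disjoint w₁′ w₂ × Disjoint w₁′ w₂′) × NonCrossing (starts p) (starts q)

  -- Consistent restricted to the region [lo, hi) and stated pair by pair (see Consistent⇒ConsistentIn).
  ConsistentIn : ℕ → ℕ → List Pair → Set
  ConsistentIn lo hi S = All (Within lo hi) S × AllPairs Compatible S

  Complementary : List A → Pair → Set
  Complementary x (w , w′) = sub x w′ ≡ barStr (sub x w)

  pairSize : Pair → ℕ
  pairSize (w , w′) = len w + len w′

  size : List Pair → ℕ
  size S = sum (map pairSize S)

  sizeP≡size : ∀ S → sizeP S ≡ size S
  sizeP≡size []      = refl
  sizeP≡size (p ∷ S) = trans (cong (len (proj₁ p) +_) (cong (len (proj₂ p) +_) (sizeP≡size S)))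
                             (sym (+-assoc (len (proj₁ p)) _ _))

  Disjoint-sym : Symmetric Disjoint
  Disjoint-sym (inj₁ h) = inj₂ h
  Disjoint-sym (inj₂ h) = inj₁ h

  NonCrossing-sym : Symmetric NonCrossing
  NonCrossing-sym (inj₁ h)               = inj₂ (inj₁ h)
  NonCrossing-sym (inj₂ (inj₁ h))        = inj₁ h
  NonCrossing-sym (inj₂ (inj₂ (inj₁ h))) = inj₂ (inj₂ (inj₂ h))
  NonCrossing-sym (inj₂ (inj₂ (inj₂ h))) = inj₂ (inj₂ (inj₁ h))

  Compatible-sym : Symmetric Compatible
  Compatible-sym ((d₁ , d₂ , d₃ , d₄) , nc) =
    (Disjoint-sym d₁ , Disjoint-sym d₃ , Disjoint-sym d₂ , Disjoint-sym d₄) , NonCrossing-sym nc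

  shiftPair : ℕ → Pair → Pair
  shiftPair k ((s , l) , (s′ , l′)) = (k + s , l) , (k + s′ , l′)

  shift : ℕ → List Pair → List Pair
  shift k = map (shiftPair k)

  size-shift : ∀ k S → size (shift k S) ≡ size S
  size-shift k S = cong sum (sym (map-∘ S))

  Within-shift : ∀ k {lo hi p} → Within lo hi p → Within (k + lo) (k + hi) (shiftPair k p)
  Within-shift k (l>0 , lo≤s , w<w′ , l′>0 , w′≤hi) =
    l>0 , +-monoʳ-≤ k lo≤s , +-monoʳ-end k w<w′ , l′>0 , +-monoʳ-end k w′≤hi

  Disjoint-shift : ∀ k {s l s′ l′} → Disjoint (s , l) (s′ , l′) → Disjoint (k + s , l) (k + s′ , l′)
  Disjoint-shift k (inj₁ h) = inj₁ (+-monoʳ-end k h)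
  Disjoint-shift k (inj₂ h) = inj₂ (+-monoʳ-end k h)

  NonCrossing-shift : ∀ k {a b a′ b′} → NonCrossing (a , b) (a′ , b′) →
                      NonCrossing (k + a , k + b) (k + a′ , k + b′)
  NonCrossing-shift k (inj₁ h)                        = inj₁ (+-monoʳ-< k h)
  NonCrossing-shift k (inj₂ (inj₁ h))                 = inj₂ (inj₁ (+-monoʳ-< k h))
  NonCrossing-shift k (inj₂ (inj₂ (inj₁ (h₁ , h₂ , h₃)))) =
    inj₂ (inj₂ (inj₁ (+-monoʳ-< k h₁ , +-monoʳ-< k h₂ , +-monoʳ-< k h₃)))
  NonCrossing-shift k (inj₂ (inj₂ (inj₂ (h₁ , h₂ , h₃)))) =
    inj₂ (inj₂ (inj₂ (+-monoʳ-< k h₁ , +-monoʳ-< k h₂ , +-monoʳ-< k h₃)))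

  Compatible-shift : ∀ k {p q} → Compatible p q → Compatible (shiftPair k p) (shiftPair k q)
  Compatible-shift k ((d₁ , d₂ , d₃ , d₄) , nc) =
    (Disjoint-shift k d₁ , Disjoint-shift k d₂ , Disjoint-shift k d₃ , Disjoint-shift k d₄) , NonCrossing-shift k nc

  ConsistentIn-shift : ∀ k {lo hi S} → ConsistentIn lo hi S → ConsistentIn (k + lo) (k + hi) (shift k S)
  ConsistentIn-shift k (ws , cs) =
    All.map⁺ (All.map (Within-shift k) ws) , AllPairs.map⁺ (AllPairs.map (Compatible-shift k) cs)

  Within-mono : ∀ {lo hi lo′ hi′ p} → lo′ ≤ lo → hi ≤ hi′ → Within lo hi p → Within lo′ hi′ p
  Within-mono lo′≤lo hi≤hi′ (l>0 , lo≤s , w<w′ , l′>0 , w′≤hi) =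
    l>0 , ≤-trans lo′≤lo lo≤s , w<w′ , l′>0 , ≤-trans w′≤hi hi≤hi′

  ConsistentIn-mono : ∀ {lo hi lo′ hi′ S} → lo′ ≤ lo → hi ≤ hi′ → ConsistentIn lo hi S → ConsistentIn lo′ hi′ S
  ConsistentIn-mono lo′≤lo hi≤hi′ (ws , cs) = All.map (Within-mono lo′≤lo hi≤hi′) ws , cs

  Compatible-separated : ∀ {lo mid hi p q} → Within lo mid p → Within mid hi q → Compatible p q
  Compatible-separated {p = (s₁ , l₁) , (s₁′ , l₁′)} {q = (s₂ , l₂) , (s₂′ , l₂′)}
                       (_ , _ , w₁<w₁′ , l₁′>0 , w₁′≤mid) (_ , mid≤s₂ , w₂<w₂′ , _ , _) =
    (inj₁ (w₁≤ w₁′≤s₂) , inj₁ (w₁≤ w₁′≤s₂′) , inj₁ w₁′≤s₂ , inj₁ w₁′≤s₂′) ,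
    inj₁ (m+n≤o⇒m<o s₁′ l₁′>0 w₁′≤s₂)
    where
    w₁′≤s₂ : s₁′ + l₁′ ≤ s₂
    w₁′≤s₂ = ≤-trans w₁′≤mid mid≤s₂
    w₁′≤s₂′ : s₁′ + l₁′ ≤ s₂′
    w₁′≤s₂′ = ≤-trans w₁′≤s₂ (m+n≤o⇒m≤o s₂ w₂<w₂′)
    w₁≤ : ∀ {t} → s₁′ + l₁′ ≤ t → s₁ + l₁ ≤ t
    w₁≤ h = ≤-trans w₁<w₁′ (m+n≤o⇒m≤o s₁′ h)

  ConsistentIn-++ : ∀ {lo mid hi S T} → lo ≤ mid → mid ≤ hi → ConsistentIn lo mid S → ConsistentIn mid hi T →
                    ConsistentIn lo hi (S ++ T)
  ConsistentIn-++ lo≤mid mid≤hi (ws , cs) (ws′ , cs′) =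
    All.++⁺ (All.map (Within-mono ≤-refl mid≤hi) ws) (All.map (Within-mono lo≤mid ≤-refl) ws′) ,
    AllPairs.++⁺ cs cs′ (All.map (λ w → All.map (Compatible-separated w) ws′) ws)

  Compatible-enclosing : ∀ {lo l s′ l′ q} → 1 ≤ l → Within (lo + l) s′ q → Compatible ((lo , l) , (s′ , l′)) q
  Compatible-enclosing {lo} {q = (a , m) , (b , m′)} l>0 (m>0 , lo+l≤a , v<v′ , m′>0 , v′≤s′) =
    (inj₁ lo+l≤a , inj₁ (≤-trans lo+l≤a a≤b) , inj₂ (≤-trans v<v′ b≤s′) , inj₂ v′≤s′) ,
    inj₂ (inj₂ (inj₁ (m+n≤o⇒m<o lo l>0 lo+l≤a , m+n≤o⇒m<o a m>0 v<v′ , m+n≤o⇒m<o b m′>0 v′≤s′)))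
    where
    a≤b = m+n≤o⇒m≤o a v<v′
    b≤s′ = m+n≤o⇒m≤o b v′≤s′

  ConsistentIn-enclosing : ∀ {lo l s′ l′ hi T} → Within lo hi ((lo , l) , (s′ , l′)) → ConsistentIn (lo + l) s′ T →
                           ConsistentIn lo hi (((lo , l) , (s′ , l′)) ∷ T)
  ConsistentIn-enclosing {lo} {l} w@(l>0 , _ , _ , _ , w′≤hi) (ws , cs) =
    w ∷ All.map (Within-mono (m≤m+n lo l) (m+n≤o⇒m≤o _ w′≤hi)) ws ,
    All.map (Compatible-enclosing l>0) ws ∷ cs

  All-allWindows⁺ : ∀ {P : Pred Window 0ℓ} {S} → All (λ q → P (proj₁ q) × P (proj₂ q)) S → All P (allWindows S)
  All-allWindows⁺ []                = []
  All-allWindows⁺ ((pw , pw′) ∷ ps) = pw ∷ pw′ ∷ All-allWindows⁺ ps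

  All-allWindows⁻ : ∀ {P : Pred Window 0ℓ} S → All P (allWindows S) → All (λ q → P (proj₁ q) × P (proj₂ q)) S
  All-allWindows⁻ []      []              = []
  All-allWindows⁻ (_ ∷ S) (pw ∷ pw′ ∷ ps) = (pw , pw′) ∷ All-allWindows⁻ S ps

  Within⇒valid : ∀ {n p} → Within 0 n p →
                 ValidWindow n (proj₁ p) × ValidWindow n (proj₂ p) × start (proj₁ p) < start (proj₂ p)
  Within⇒valid {p = (s , l) , (s′ , l′)} (l>0 , _ , w<w′ , l′>0 , w′≤n) =
    (l>0 , ≤-trans w<w′ (m+n≤o⇒m≤o s′ w′≤n)) , (l′>0 , w′≤n) , m+n≤o⇒m<o s l>0 w<w′

  valid⇒Within : ∀ {n p} → ValidWindow n (proj₁ p) × ValidWindow n (proj₂ p) × start (proj₁ p) < start (proj₂ p) →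
                 Disjoint (proj₁ p) (proj₂ p) → Within 0 n p
  valid⇒Within ((l>0 , _) , (l′>0 , w′≤n) , _)   (inj₁ w<w′) = l>0 , z≤n , w<w′ , l′>0 , w′≤n
  valid⇒Within {p = _ , (s′ , _)} (_ , _ , s<s′) (inj₂ w′<w) = ⊥-elim (<⇒≱ s<s′ (m+n≤o⇒m≤o s′ w′<w))

  ConsistentIn⇒Consistent : ∀ {n S} → ConsistentIn 0 n S → Consistent n S
  ConsistentIn⇒Consistent ([] , []) = [] , [] , []
  ConsistentIn⇒Consistent (w ∷ ws , c ∷ cs) with vs , ds , ns ← ConsistentIn⇒Consistent (ws , cs) =
    Within⇒valid w ∷ vs ,
    (inj₁ (proj₁ (proj₂ (proj₂ w))) ∷ All-allWindows⁺ (All.map (λ (d , _) → proj₁ d , proj₁ (proj₂ d)) c)) ∷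
      All-allWindows⁺ (All.map (λ (d , _) → proj₂ (proj₂ d)) c) ∷ ds ,
    All.map⁺ (All.map proj₂ c) ∷ ns

  Consistent⇒ConsistentIn : ∀ {n} S → Consistent n S → ConsistentIn 0 n S
  Consistent⇒ConsistentIn []      _ = [] , []
  Consistent⇒ConsistentIn (p ∷ S) (v ∷ vs , (d ∷ dw) ∷ dw′ ∷ ds , n ∷ ns)
    with ws , cs ← Consistent⇒ConsistentIn S (vs , ds , ns) =
    valid⇒Within v d ∷ ws ,
    All.zipWith (λ (((d₁ , d₂) , (d₃ , d₄)) , nc) → (d₁ , d₂ , d₃ , d₄) , nc)
                (All.zipWith id (All-allWindows⁻ S dw , All-allWindows⁻ S dw′) , All.map⁻ n) ∷ cs

  Complementary-shift : ∀ (u : List A) {x p} → Complementary x p →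
                        Complementary (u ++ x) (shiftPair (length u) p)
  Complementary-shift u {x} {(s , l) , (s′ , l′)} c =
    trans (sub-++ʳ u x s′ l′) (trans c (cong barStr (sym (sub-++ʳ u x s l))))

  Complementary-++ : ∀ {x} (v : List A) {lo p} → Within lo (length x) p → Complementary x p →
                     Complementary (x ++ v) p
  Complementary-++ {x} v {p = (s , l) , (s′ , l′)} (_ , _ , w<w′ , _ , w′≤n) c =
    trans (sub-++ˡ x v s′ l′ w′≤n) (trans c (cong barStr (sym (sub-++ˡ x v s l w≤n))))
    where
    w≤n = ≤-trans w<w′ (m+n≤o⇒m≤o s′ w′≤n)

  Within⇒< : ∀ {lo hi p} → Within lo hi p → lo < hi
  Within⇒< {p = (s , l) , (s′ , l′)} (l>0 , lo≤s , w<w′ , _ , w′≤hi) =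
    ≤-<-trans lo≤s (m+n≤o⇒m<o s l>0 (≤-trans w<w′ (m+n≤o⇒m≤o s′ w′≤hi)))

  Within-skip : ∀ {lo hi p} → Within lo hi p → start (proj₁ p) ≢ lo → Within (suc lo) hi p
  Within-skip (l>0 , lo≤s , w<w′ , l′>0 , w′≤hi) s≢lo = l>0 , ≤∧≢⇒< lo≤s (s≢lo ∘ sym) , w<w′ , l′>0 , w′≤hi

  Within-inner : ∀ {lo hi l s′ l′ q} → start (proj₁ q) < s′ →
                 Within lo hi q → Compatible ((lo , l) , (s′ , l′)) q → Within (lo + l) s′ q
  Within-inner {lo} {l = l} {s′} {l′} {(a , m) , (b , m′)} a<s′
               (m>0 , lo≤a , v<v′ , m′>0 , _) ((d₁ , _ , _ , d₄) , nc) =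
    m>0 , after-w d₁ , v<v′ , m′>0 , before-w′ d₄
    where
    b<s′ : NonCrossing (lo , s′) (a , b) → b < s′
    b<s′ (inj₁ s′<a)                  = ⊥-elim (<-asym a<s′ s′<a)
    b<s′ (inj₂ (inj₁ b<lo))           = ⊥-elim (<⇒≱ b<lo (≤-trans lo≤a (m+n≤o⇒m≤o a v<v′)))
    b<s′ (inj₂ (inj₂ (inj₁ (_ , _ , h)))) = h
    b<s′ (inj₂ (inj₂ (inj₂ (a<lo , _)))) = ⊥-elim (<⇒≱ a<lo lo≤a)
    after-w : Disjoint (lo , l) (a , m) → lo + l ≤ a
    after-w (inj₁ h) = h
    after-w (inj₂ h) = ⊥-elim (<⇒≱ (m+n≤o⇒m<o a m>0 h) lo≤a)
    before-w′ : Disjoint (s′ , l′) (b , m′) → b + m′ ≤ s′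
    before-w′ (inj₁ h) = ⊥-elim (<⇒≱ (b<s′ nc) (m+n≤o⇒m≤o s′ h))
    before-w′ (inj₂ h) = h

  Within-outer : ∀ {lo hi l s′ l′ q} → ¬ start (proj₁ q) < s′ →
                 Within lo hi q → Compatible ((lo , l) , (s′ , l′)) q → Within (s′ + l′) hi q
  Within-outer {s′ = s′} {l′} {(a , m) , _} a≮s′
               (m>0 , _ , v<v′ , m′>0 , v′≤hi) ((_ , _ , d₃ , _) , _) =
    m>0 , after-w′ d₃ , v<v′ , m′>0 , v′≤hi
    where
    after-w′ : Disjoint (s′ , l′) (a , m) → s′ + l′ ≤ a
    after-w′ (inj₁ h) = h
    after-w′ (inj₂ h) = ⊥-elim (a≮s′ (m+n≤o⇒m<o a m>0 h))

  -- fold ≤ fold_ρ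

  FoldWithin : List A → ℕ → ℕ → ℕ → Set
  FoldWithin x lo hi n = Σ[ y ∈ List A ] (y ⊆ seg x lo hi × FOLD y × n ≤ length y)

  -- m bounds the length of the region; fold-covers recurses on it.
  FoldCovers : List A → ℕ → Set
  FoldCovers x m = ∀ {lo hi S} → hi ≤ lo + m → hi ≤ length x → ConsistentIn lo hi S → All (Complementary x) S →
                   FoldWithin x lo hi (size S)

  fold-empty-region : ∀ {x lo hi S} → ¬ lo < hi → All (Within lo hi) S → FoldWithin x lo hi (size S)
  fold-empty-region lo≮hi []      = [] , minimum _ , fold-empty , z≤n
  fold-empty-region lo≮hi (w ∷ _) = ⊥-elim (lo≮hi (Within⇒< w))

  fold-skip : ∀ {x m lo hi S} → FoldCovers x m → lo < hi → hi ≤ lo + suc m → hi ≤ length x →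
              ConsistentIn lo hi S → All (Complementary x) S → All (λ q → start (proj₁ q) ≢ lo) S →
              FoldWithin x lo hi (size S)
  fold-skip {x} {m} {lo} IH lo<hi bound hi≤n (ws , cs) comps none
    with y , y⊆ , fy , size≤ ← IH (≤-trans bound (≤-reflexive (+-suc lo m))) hi≤n
                                   (All.zipWith (uncurry Within-skip) (ws , none) , cs) comps =
    y , subst (y ⊆_) (sym (seg-split x (n≤1+n lo) lo<hi)) (++⁺ˡ _ y⊆) , fy , size≤

  FoldWithin-around : ∀ {x lo l s′ l′ hi n₁ n₂} → lo + l ≤ s′ → s′ + l′ ≤ hi → hi ≤ length x →
                      Complementary x ((lo , l) , (s′ , l′)) →
                      FoldWithin x (lo + l) s′ n₁ → FoldWithin x (s′ + l′) hi n₂ →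
                      FoldWithin x lo hi (l + l′ + (n₁ + n₂))
  FoldWithin-around {x} {lo} {l} {s′} {l′} {hi} {n₁} {n₂} w<w′ w′≤hi hi≤n cp
                    (y₁ , y₁⊆ , f₁ , n₁≤) (y₂ , y₂⊆ , f₂ , n₂≤) =
    y , y⊆ , fy , n≤
    where
    w = sub x (lo , l)
    y = w ++ y₁ ++ barStr w ++ y₂
    w′≡ : seg x s′ (s′ + l′) ≡ barStr w
    w′≡ = trans (seg-sub x s′ l′) cp
    s′≤hi = m+n≤o⇒m≤o s′ w′≤hi
    segments : seg x lo hi ≡ seg x lo (lo + l) ++ seg x (lo + l) s′ ++ seg x s′ (s′ + l′) ++ seg x (s′ + l′) hi
    segments = begin
      seg x lo hi                                                    ≡⟨ seg-split x (m≤m+n lo l) (≤-trans w<w′ s′≤hi) ⟩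
      seg x lo (lo + l) ++ seg x (lo + l) hi                         ≡⟨ cong (seg x lo (lo + l) ++_) (seg-split x w<w′ s′≤hi) ⟩
      seg x lo (lo + l) ++ seg x (lo + l) s′ ++ seg x s′ hi          ≡⟨ cong (λ z → seg x lo (lo + l) ++ seg x (lo + l) s′ ++ z)
                                                                             (seg-split x (m≤m+n s′ l′) w′≤hi) ⟩
      seg x lo (lo + l) ++ seg x (lo + l) s′ ++ seg x s′ (s′ + l′) ++ seg x (s′ + l′) hi ∎
      where open ≡-Reasoning
    y⊆ : y ⊆ seg x lo hi
    y⊆ = subst (y ⊆_) (sym segments)
           (++⁺ (⊆-reflexive (sym (seg-sub x lo l))) (++⁺ y₁⊆ (++⁺ (⊆-reflexive (sym w′≡)) y₂⊆)))
    fy : FOLD y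
    fy = subst FOLD (trans (++-assoc w _ y₂) (cong (w ++_) (++-assoc y₁ _ y₂))) (fold-cat (FOLD-wrap w f₁) f₂)
    length-w : length w ≡ l
    length-w = length-take-drop x lo l (≤-trans (≤-trans w<w′ (m≤m+n s′ l′)) (≤-trans w′≤hi hi≤n))
    length-w′ : length (barStr w) ≡ l′
    length-w′ = trans (cong length (sym cp)) (length-take-drop x s′ l′ (≤-trans w′≤hi hi≤n))
    n≤ : l + l′ + (n₁ + n₂) ≤ length y
    n≤ = begin
      l + l′ + (n₁ + n₂)                     ≤⟨ +-monoʳ-≤ (l + l′) (+-mono-≤ n₁≤ n₂≤) ⟩
      l + l′ + (length y₁ + length y₂)       ≡⟨ interchange l l′ (length y₁) (length y₂) ⟩
      (l + length y₁) + (l′ + length y₂)     ≡⟨ +-assoc l (length y₁) (l′ + length y₂) ⟩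
      l + (length y₁ + (l′ + length y₂))     ≡⟨ cong₂ (λ a b → a + (length y₁ + (b + length y₂))) length-w length-w′ ⟨
      length w + (length y₁ + (length (barStr w) + length y₂)) ≡⟨ lengths ⟨
      length y ∎
      where
      open ≤-Reasoning
      lengths : length y ≡ length w + (length y₁ + (length (barStr w) + length y₂))
      lengths = trans (length-++ w)
                  (cong (length w +_) (trans (length-++ y₁) (cong (length y₁ +_) (length-++ (barStr w)))))

  fold-around : ∀ {x m lo hi T} → FoldCovers x m → hi ≤ lo + suc m → hi ≤ length x →
                ∀ p → start (proj₁ p) ≡ lo → Within lo hi p → Complementary x p →
                All (Within lo hi) T → All (Compatible p) T → AllPairs Compatible T → All (Complementary x) T →
                FoldWithin x lo hi (pairSize p + size T)
  fold-around {x} {m} {lo} {hi} {T} IH bound hi≤n ((_ , l) , (s′ , l′)) refl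
              (l>0 , _ , w<w′ , l′>0 , w′≤hi) cp ws cs′ cs comps =
    subst (FoldWithin x lo hi) (cong (l + l′ +_) (sym (sum-map-filter pairSize inner? T)))
      (FoldWithin-around {lo = lo} {l} w<w′ w′≤hi hi≤n cp
        (IH inner-bound (≤-trans (m+n≤o⇒m≤o s′ w′≤hi) hi≤n)
            (All.zipWith (λ (lt , w , c) → Within-inner lt w c) (All.all-filter inner? T , beside inner?) ,
             AllPairs.filter⁺ inner? cs)
            (All.filter⁺ inner? comps))
        (IH outer-bound hi≤n
            (All.zipWith (λ (nlt , w , c) → Within-outer nlt w c)
                         (All.all-filter (∁? inner?) T , beside (∁? inner?)) ,
             AllPairs.filter⁺ (∁? inner?) cs)
            (All.filter⁺ (∁? inner?) comps)))
    where
    inner? : Decidable (λ q → start (proj₁ q) < s′)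
    inner? q = start (proj₁ q) <? s′
    beside : ∀ {P : Pred Pair 0ℓ} (P? : Decidable P) →
             All (λ q → Within lo hi q × Compatible ((lo , l) , (s′ , l′)) q) (filter P? T)
    beside P? = All.filter⁺ P? (All.zipWith id (ws , cs′))
    s′<hi : suc s′ ≤ suc (lo + m)
    s′<hi = ≤-trans (m+n≤o⇒m<o s′ l′>0 w′≤hi) (≤-trans bound (≤-reflexive (+-suc lo m)))
    inner-bound : s′ ≤ lo + l + m
    inner-bound = ≤-trans (≤-pred s′<hi) (+-monoˡ-≤ m (m≤m+n lo l))
    outer-bound : hi ≤ s′ + l′ + m
    outer-bound = ≤-trans bound (≤-trans (≤-reflexive (+-suc lo m))
                    (+-monoˡ-≤ m (m+n≤o⇒m<o lo l>0 (≤-trans w<w′ (m≤m+n s′ l′)))))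

  fold-covers : ∀ x m → FoldCovers x m
  fold-covers x zero    {lo} bound _ (ws , _) _ =
    fold-empty-region (λ lo<hi → <⇒≱ lo<hi (≤-trans bound (≤-reflexive (+-identityʳ lo)))) ws
  fold-covers x (suc m) {lo} {hi} {S} bound hi≤n c@(ws , cs) comps
    with lo <? hi | any? (λ q → start (proj₁ q) ≟ lo) S
  ... | no lo≮hi | _      = fold-empty-region lo≮hi ws
  ... | yes lo<hi | no none = fold-skip (fold-covers x m) lo<hi bound hi≤n c comps (All.¬Any⇒All¬ S none)
  ... | yes _     | yes i
    with wp , start≡lo ← All.lookupAny ws i
       | cp , _ ← All.lookupAny comps i
       | cs′ , csᵢ ← AllPairs-─ Compatible-sym i cs =
    subst (FoldWithin x lo hi) (sym (sum-map-─ pairSize i))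
      (fold-around (fold-covers x m) bound hi≤n (Any.lookup i) start≡lo wp cp
                   (All.─⁺ i ws) cs′ csᵢ (All.─⁺ i comps))

  fold≤foldρCost : ∀ {x f} ρ → IsFold x f → ∀ {S} → WindowAlignment x S → f ≤ foldρCost ρ x S
  fold≤foldρCost {x} {f} ρ (_ , minimal) {S} (consistent , comps)
    with y , y⊆ , fy , size≤ ← fold-covers x (length x) ≤-refl ≤-refl
                                  (Consistent⇒ConsistentIn S consistent) comps =
    begin
      f                    ≤⟨ minimal _ (y , subst (y ⊆_) (take-all (length x) x ≤-refl) y⊆ , fy , refl) ⟩
      length x ∸ length y  ≤⟨ ∸-monoʳ-≤ (length x) size≤ ⟩
      length x ∸ size S    ≡⟨ cong (length x ∸_) (sizeP≡size S) ⟨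
      length x ∸ sizeP S   ≤⟨ m≤m+n _ _ ⟩
      foldρCost ρ x S      ∎
    where open ≤-Reasoning

  -- fold_ρ ≤ (1 + 2ρ) fold − ρ for irreducible x

  data Dyck : List A → Set where
    ε    : Dyck []
    node : ∀ a {u v} → Dyck u → Dyck v → Dyck (a ∷ u ++ bar a ∷ v)

  Dyck-++ : ∀ {u w} → Dyck u → Dyck w → Dyck (u ++ w)
  Dyck-++ ε                      dw = dw
  Dyck-++ {w = w} (node a {u} {v} du dv) dw =
    subst Dyck (cong (a ∷_) (sym (++-assoc u (bar a ∷ v) w))) (node a du (Dyck-++ dv dw))

  FOLD⇒Dyck : ∀ {y} → FOLD y → Dyck y
  FOLD⇒Dyck fold-empty      = ε
  FOLD⇒Dyck (fold-cat f g)  = Dyck-++ (FOLD⇒Dyck f) (FOLD⇒Dyck g)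
  FOLD⇒Dyck (fold-wrap a f) = node a (FOLD⇒Dyck f) ε

  data Chains : List A → Set where
    ε     : Chains []
    skip  : ∀ a {x} → Chains x → Chains (a ∷ x)
    chain : ∀ a u {m r} → Chains m → Chains r → Chains ((a ∷ u) ++ m ++ barStr (a ∷ u) ++ r)

  deletions : ∀ {x} → Chains x → ℕ
  deletions ε               = 0
  deletions (skip _ t)      = suc (deletions t)
  deletions (chain _ _ m r) = deletions m + deletions r

  chainCount : ∀ {x} → Chains x → ℕ
  chainCount ε               = 0
  chainCount (skip _ t)      = chainCount t
  chainCount (chain _ _ m r) = suc (chainCount m + chainCount r)

  rootCount : ∀ {x} → Chains x → ℕ
  rootCount ε               = 0
  rootCount (skip _ t)      = suc (rootCount t)
  rootCount (chain _ _ _ r) = suc (rootCount r)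

  Bounded : ∀ {x} → Chains x → Set
  Bounded t = chainCount t + rootCount t ≤ 2 * deletions t

  two-roots : ∀ {x} (t : Chains x) → 2 ≤ rootCount t → Bounded t → chainCount t + 2 ≤ 2 * deletions t
  two-roots t 2≤i h = ≤-trans (+-monoʳ-≤ (chainCount t) 2≤i) h

  ChainsWith : List A → ℕ → Set
  ChainsWith x d = Σ[ t ∈ Chains x ] (deletions t ≡ d × Bounded t)

  new-chain : ∀ a {xin x₃} (tin : Chains xin) → chainCount tin + 2 ≤ 2 * deletions tin →
              (tr : Chains x₃) → Bounded tr → ChainsWith (a ∷ xin ++ bar a ∷ x₃) (deletions tin + deletions tr)
  new-chain a tin h tr br = chain a [] tin tr , refl , new-chain-bound (deletions tin) (deletions tr) h br

  extend-enclosure : ∀ a (w m r : List A) →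
                     a ∷ (w ++ m ++ barStr w ++ []) ++ bar a ∷ r ≡ (a ∷ w) ++ m ++ barStr (a ∷ w) ++ r
  extend-enclosure a w m r = cong (a ∷_) (begin
    (w ++ m ++ barStr w ++ []) ++ bar a ∷ r  ≡⟨ cong (λ z → (w ++ m ++ z) ++ bar a ∷ r) (++-identityʳ (barStr w)) ⟩
    (w ++ m ++ barStr w) ++ bar a ∷ r        ≡⟨ ++-assoc w _ _ ⟩
    w ++ (m ++ barStr w) ++ bar a ∷ r        ≡⟨ cong (w ++_) (++-assoc m _ _) ⟩
    w ++ m ++ barStr w ++ bar a ∷ r          ≡⟨ cong (λ z → w ++ m ++ z) (++-assoc (barStr w) (bar a ∷ []) r) ⟨
    w ++ m ++ (barStr w ++ bar a ∷ []) ++ r  ≡⟨ cong (λ z → w ++ m ++ z ++ r) (barStr-∷ a w) ⟨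
    w ++ m ++ barStr (a ∷ w) ++ r            ∎)
    where open ≡-Reasoning

  enclose : ∀ a {xin x₃} → xin ≢ [] → (tin : Chains xin) → Bounded tin →
            (tr : Chains x₃) → Bounded tr → ChainsWith (a ∷ xin ++ bar a ∷ x₃) (deletions tin + deletions tr)
  enclose a xin≢[] ε              _ = ⊥-elim (xin≢[] refl)
  enclose a _      tin@(skip _ ε) _ = new-chain a tin ≤-refl
  enclose a _      (chain b u {m} {[]} tm ε) btin tr btr =
    subst (λ z → ChainsWith z (deletions tm + 0 + deletions tr)) (sym (extend-enclosure a (b ∷ u) m _))
      (chain a (b ∷ u) tm tr , cong (_+ deletions tr) (sym (+-identityʳ (deletions tm))) ,
       new-chain-bound (deletions tm) (deletions tr)
         (subst₂ _≤_ count-eq (cong (2 *_) (+-identityʳ (deletions tm))) btin) btr)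
    where
    count-eq : suc (chainCount tm + 0) + 1 ≡ chainCount tm + 2
    count-eq = trans (cong (λ k → suc k + 1) (+-identityʳ (chainCount tm))) (sym (+-suc (chainCount tm) 1))
  enclose a _ tin@(skip _ (skip _ _))           btin = new-chain a tin (two-roots tin (s≤s (s≤s z≤n)) btin)
  enclose a _ tin@(skip _ (chain _ _ _ _))      btin = new-chain a tin (two-roots tin (s≤s (s≤s z≤n)) btin)
  enclose a _ tin@(chain _ _ _ (skip _ _))      btin = new-chain a tin (two-roots tin (s≤s (s≤s z≤n)) btin)
  enclose a _ tin@(chain _ _ _ (chain _ _ _ _)) btin = new-chain a tin (two-roots tin (s≤s (s≤s z≤n)) btin)

  skip-bound : ∀ {x} a (t : Chains x) → Bounded t → Bounded (skip a t)
  skip-bound a t bt = ≤-trans (≤-reflexive (+-suc (chainCount t) (rootCount t)))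
                        (≤-trans (s≤s (m≤n⇒m≤1+n bt)) (≤-reflexive (sym (*-suc 2 (deletions t)))))

  enclosed-nonempty : ∀ a {x₁ x₃} → Irreducible (a ∷ x₁ ++ bar a ∷ x₃) → x₁ ≢ []
  enclosed-nonempty a {[]}    (a≁ā ∷ _) refl = a≁ā refl
  enclosed-nonempty a {_ ∷ _} _         ()

  chains-of : ∀ {x y} → Dyck y → y ⊆ x → Irreducible x →
              Σ[ t ∈ Chains x ] (deletions t + length y ≡ length x × Bounded t)
  chains-of d (b ∷ʳ y⊆) irr with t , len≡ , bt ← chains-of d y⊆ (Linked.tail irr) =
    skip b t , cong suc len≡ , skip-bound b t bt
  chains-of ε [] _ = ε , refl , z≤n
  chains-of (node a {u} {v} du dv) (refl ∷ y⊆) irr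
    with x₁ , x₃ , refl , u⊆ , v⊆ ← ⊆-++-∷⁻ u y⊆
    with tin , len₁ , b₁ ← chains-of du u⊆ (Linked.tail (Linked-++⁻ˡ (a ∷ x₁) irr))
       | tr , len₃ , b₃ ← chains-of dv v⊆ (Linked.tail (Linked-++⁻ʳ (a ∷ x₁) irr))
    with t , del≡ , bt ← enclose a (enclosed-nonempty a irr) tin b₁ tr b₃
    = t , lengths , bt
    where
    open ≡-Reasoning
    regroup : ∀ d₁ d₃ n₁ n₃ → d₁ + d₃ + suc (n₁ + suc n₃) ≡ suc (d₁ + n₁ + suc (d₃ + n₃))
    regroup = solve-∀
    lengths : deletions t + length (a ∷ u ++ bar a ∷ v) ≡ length (a ∷ x₁ ++ bar a ∷ x₃)
    lengths = begin
      deletions t + suc (length (u ++ bar a ∷ v))                 ≡⟨ cong₂ (λ d n → d + suc n) del≡ (length-++ u) ⟩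
      deletions tin + deletions tr + suc (length u + suc (length v)) ≡⟨ regroup (deletions tin) (deletions tr) _ _ ⟩
      suc (deletions tin + length u + suc (deletions tr + length v)) ≡⟨ cong₂ (λ n₁ n₃ → suc (n₁ + suc n₃)) len₁ len₃ ⟩
      suc (length x₁ + suc (length x₃))                           ≡⟨ cong suc (length-++ x₁) ⟨
      length (a ∷ x₁ ++ bar a ∷ x₃)                               ∎

  Aligned : List A → List Pair → Set
  Aligned x S = ConsistentIn 0 (length x) S × All (Complementary x) S

  Aligned-++ : ∀ {x₁ x₂ S₁ S₂} → Aligned x₁ S₁ → Aligned x₂ S₂ → Aligned (x₁ ++ x₂) (S₁ ++ shift (length x₁) S₂)
  Aligned-++ {x₁} {x₂} (c₁@(ws₁ , _) , comps₁) (c₂ , comps₂) =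
    ConsistentIn-++ z≤n x₁≤x c₁
      (ConsistentIn-mono (m≤m+n (length x₁) 0) (≤-reflexive (sym (length-++ x₁))) (ConsistentIn-shift (length x₁) c₂)) ,
    All.++⁺ (All.zipWith (uncurry (Complementary-++ x₂)) (ws₁ , comps₁))
            (All.map⁺ (All.map (λ {p} → Complementary-shift x₁ {p = p}) comps₂))
    where
    x₁≤x : length x₁ ≤ length (x₁ ++ x₂)
    x₁≤x = ≤-trans (m≤m+n (length x₁) (length x₂)) (≤-reflexive (sym (length-++ x₁)))

  Aligned-enclosing : ∀ (w : List A) {m S} → 1 ≤ length w → Aligned m S →
                      Aligned (w ++ m ++ barStr w) (((0 , length w) , (length w + length m , length w)) ∷ shift (length w) S)
  Aligned-enclosing w {m} w≢[] (c@(ws , _) , comps) =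
    ConsistentIn-enclosing (w≢[] , z≤n , m≤m+n (length w) (length m) , w≢[] , ≤-reflexive (sym length-x))
      (ConsistentIn-mono (m≤m+n (length w) 0) ≤-refl (ConsistentIn-shift (length w) c)) ,
    outer ∷ All.map⁺ (All.zipWith inner (ws , comps))
    where
    open ≡-Reasoning
    length-x : length (w ++ m ++ barStr w) ≡ length w + length m + length w
    length-x = begin
      length (w ++ m ++ barStr w)              ≡⟨ length-++ w ⟩
      length w + length (m ++ barStr w)        ≡⟨ cong (length w +_) (length-++ m) ⟩
      length w + (length m + length (barStr w)) ≡⟨ cong (λ n → length w + (length m + n)) (length-barStr w) ⟩
      length w + (length m + length w)         ≡⟨ +-assoc (length w) _ _ ⟨
      length w + length m + length w           ∎
    inner : ∀ {p} → Within 0 (length m) p × Complementary m p →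
            Complementary (w ++ m ++ barStr w) (shiftPair (length w) p)
    inner {p} (wᵢ , cᵢ) = Complementary-shift w {p = p} (Complementary-++ (barStr w) wᵢ cᵢ)
    outer : Complementary (w ++ m ++ barStr w) ((0 , length w) , (length w + length m , length w))
    outer = begin
      sub (w ++ m ++ barStr w) (length w + length m , length w) ≡⟨ sub-++ʳ w (m ++ barStr w) (length m) (length w) ⟩
      take (length w) (drop (length m) (m ++ barStr w))         ≡⟨ cong (take (length w)) (drop-length-++ m (barStr w)) ⟩
      take (length w) (barStr w)                                ≡⟨ take-all (length w) (barStr w) (≤-reflexive (length-barStr w)) ⟩
      barStr w                                                  ≡⟨ cong barStr (take-length-++ w (m ++ barStr w)) ⟨
      barStr (take (length w) (w ++ m ++ barStr w))             ∎

  Cover : List A → ℕ → ℕ → Set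
  Cover x d k = Σ[ S ∈ List Pair ] (Aligned x S × size S + d ≡ length x × length S ≡ k)

  size-++-shift : ∀ k S₁ S₂ → size (S₁ ++ shift k S₂) ≡ size S₁ + size S₂
  size-++-shift k S₁ S₂ =
    trans (cong sum (map-++ pairSize S₁ _)) (trans (sum-++ (map pairSize S₁) _) (cong (size S₁ +_) (size-shift k S₂)))

  Cover-++ : ∀ {x₁ x₂ d₁ d₂ k₁ k₂} → Cover x₁ d₁ k₁ → Cover x₂ d₂ k₂ → Cover (x₁ ++ x₂) (d₁ + d₂) (k₁ + k₂)
  Cover-++ {x₁} {x₂} {d₁} {d₂} (S₁ , al₁ , size₁ , len₁) (S₂ , al₂ , size₂ , len₂) =
    S₁ ++ shift (length x₁) S₂ , Aligned-++ al₁ al₂ , sizes , lengths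
    where
    open ≡-Reasoning
    sizes : size (S₁ ++ shift (length x₁) S₂) + (d₁ + d₂) ≡ length (x₁ ++ x₂)
    sizes = begin
      size (S₁ ++ shift (length x₁) S₂) + (d₁ + d₂) ≡⟨ cong (_+ (d₁ + d₂)) (size-++-shift (length x₁) S₁ S₂) ⟩
      size S₁ + size S₂ + (d₁ + d₂)                 ≡⟨ interchange (size S₁) (size S₂) d₁ d₂ ⟩
      (size S₁ + d₁) + (size S₂ + d₂)               ≡⟨ cong₂ _+_ size₁ size₂ ⟩
      length x₁ + length x₂                         ≡⟨ length-++ x₁ ⟨
      length (x₁ ++ x₂)                             ∎
    lengths : length (S₁ ++ shift (length x₁) S₂) ≡ _
    lengths = trans (length-++ S₁) (cong₂ _+_ len₁ (trans (length-map _ S₂) len₂))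

  Cover-enclosing : ∀ a u {m d k} → Cover m d k → Cover ((a ∷ u) ++ m ++ barStr (a ∷ u)) d (suc k)
  Cover-enclosing a u {m} {d} (S , al , size≡ , len≡) =
    _ , Aligned-enclosing (a ∷ u) (s≤s z≤n) al , sizes , cong suc (trans (length-map _ S) len≡)
    where
    open ≡-Reasoning
    L = length (a ∷ u)
    sizes : L + L + size (shift L S) + d ≡ length ((a ∷ u) ++ m ++ barStr (a ∷ u))
    sizes = begin
      L + L + size (shift L S) + d  ≡⟨ +-assoc (L + L) _ d ⟩
      L + L + (size (shift L S) + d) ≡⟨ cong (λ n → L + L + (n + d)) (size-shift L S) ⟩
      L + L + (size S + d)          ≡⟨ cong (L + L +_) size≡ ⟩
      L + L + length m              ≡⟨ trans (+-assoc L L _) (cong (L +_) (+-comm L (length m))) ⟩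
      L + (length m + L)            ≡⟨ cong (λ n → L + (length m + n)) (length-barStr (a ∷ u)) ⟨
      L + (length m + length (barStr (a ∷ u))) ≡⟨ trans (length-++ (a ∷ u)) (cong (L +_) (length-++ m)) ⟨
      length ((a ∷ u) ++ m ++ barStr (a ∷ u)) ∎

  windows : ∀ {x} (t : Chains x) → Cover x (deletions t) (chainCount t)
  windows ε                 = [] , (([] , []) , []) , refl , refl
  windows (skip a t)        = Cover-++ {x₁ = a ∷ []} ([] , (([] , []) , []) , refl , refl) (windows t)
  windows (chain a u {m} {r} tm tr) =
    subst (λ z → Cover z (deletions tm + deletions tr) (suc (chainCount tm + chainCount tr)))
          (trans (++-assoc (a ∷ u) _ r) (cong ((a ∷ u) ++_) (++-assoc m _ r)))
      (Cover-++ (Cover-enclosing a u (windows tm)) (windows tr))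

  rootCount-pos : ∀ {x} → x ≢ [] → (t : Chains x) → 1 ≤ rootCount t
  rootCount-pos x≢[] ε               = ⊥-elim (x≢[] refl)
  rootCount-pos _    (skip _ _)      = s≤s z≤n
  rootCount-pos _    (chain _ _ _ _) = s≤s z≤n

  foldρ-bound : ∀ {x f fρ} ρ → x ≢ [] → Irreducible x → IsFold x f → IsFoldρ ρ x fρ →
                fρ + ρ ≤ (1 + 2 * ρ) * f
  foldρ-bound {x} {f} {fρ} ρ x≢[] irr ((y , y⊆ , fy , f≡) , _) (_ , minimal)
    with t , len≡ , bt ← chains-of (FOLD⇒Dyck fy) y⊆ irr
    with S , (c , comps) , size≡ , count≡ ← windows t = begin
      fρ + ρ                               ≤⟨ +-monoˡ-≤ ρ (minimal _ (S , (ConsistentIn⇒Consistent c , comps) , refl)) ⟩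
      foldρCost ρ x S + ρ                  ≡⟨ cong (_+ ρ) (cong₂ _+_ uncovered (cong (ρ *_) count≡)) ⟩
      deletions t + ρ * chainCount t + ρ   ≤⟨ cost-bound ρ (≤-trans (+-monoʳ-≤ (chainCount t) (rootCount-pos x≢[] t)) bt) ⟩
      (1 + 2 * ρ) * deletions t            ≡⟨ cong ((1 + 2 * ρ) *_) f≡deletions ⟨
      (1 + 2 * ρ) * f                      ∎
    where
    open ≤-Reasoning
    uncovered : length x ∸ sizeP S ≡ deletions t
    uncovered = trans (cong₂ _∸_ (sym size≡) (sizeP≡size S)) (m+n∸m≡n (size S) (deletions t))
    f≡deletions : f ≡ deletions t
    f≡deletions = trans f≡ (trans (cong (_∸ length y) (sym len≡)) (m+n∸n≡m (deletions t) (length y)))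

lemma6p8 : (A : Set) (bar : A → A) → DecidableEquality A
    → (∀ a → bar (bar a) ≡ a) → (∀ a → bar a ≢ a)
    → (x : List A) (ρ f fρ : ℕ)
    → Folding.IsFold bar x f → Folding.IsFoldρ bar ρ x fρ
    → f ≤ fρ × (x ≢ [] → Folding.Irreducible bar x → fρ + ρ ≤ (1 + 2 * ρ) * f)
lemma6p8 A bar _ _ _ x ρ f fρ isFold isFoldρ@((_ , alignment , fρ≡cost) , _) =
  subst (f ≤_) (sym fρ≡cost) (fold≤foldρCost bar ρ isFold alignment) ,
  λ x≢[] irr → foldρ-bound bar ρ x≢[] irr isFold isFoldρ
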